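{- Let $G$ be a split graph with clusters as in the context, and let $I_s, I_t$ be typical independent sets of $G$ with $|I_s| = |I_t|$. If some cluster is Free for both $I_s$ and $I_t$ (i.e., $\mathcal{F}(I_s) \cap \mathcal{F}(I_t) \neq \emptyset$), then $I_s \rightsquigarrow_2 I_t$.
   Context: For independent sets $I, J$ of $G$, write $I \leftrightarrow_2 J$ if $|I \setminus J| = |J \setminus I| = 1$ and $\mathrm{dist}_G(u,v) \le 2$ where $I \setminus J = \{u\}$, $J \setminus I = \{v\}$; write $I \rightsquigarrow_2 J$ if there is a finite sequence $I = I_0, \dots, I_\ell = J$ ($\ell \ge 0$) of independent sets with $I_j \leftrightarrow_2 I_{j+1}$ for all $j$. Setting: $G$ is a split graph with vertex set partitioned as $V^A \cup U^B$, where $V^A$ is a clique and $U^B$ is an independent set, and every vertex of $U^B$ has a neighbor in $V^A$. Let $V^B \subseteq V^A$ be the set of vertices of $V^A$ having a neighbor in $U^B$, and let $G^B$ be the bipartite graph with parts $V^B$ and $U^B$ whose edges are the edges of $G$ between $V^A$ and $U^B$. A cluster is a connected component of $G^B$, written $(U_C, V_C, E_C)$ with $U_C \subseteq U^B$, $V_C \subseteq V^B$; in addition, if $V' = V^A \setminus V^B \neq \emptyset$, then $(\emptyset, V', \emptyset)$ is also a cluster. The clusters are $C_0, \dots, C_{m-1}$, $C_i = (U_i, V_i, E_i)$. For each $i$ fix a vertex $v^{\min}_i \in V_i$ of minimum degree in $C_i$ and let $N_i = N_{C_i}(v^{\min}_i)$. A typical independent set is an independent set $I$ of $G$ with $I \cap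 V^A = \emptyset$; its distribution is $(|I \cap U_i|)_{0 \le i \le m-1}$. For a typical independent set $I$, let $\phi_i(I) = \min\{|N_i \cap J| : J \text{ a typical independent set with the same distribution as } I\}$; $C_i$ is Free for $I$ if $\phi_i(I) = 0$. $\mathcal{F}(I)$ denotes the set of clusters that are Free for $I$. -}

module Defs where

open import Data.Nat using (ℕ; _≤_)
open import Data.Fin using (Fin)
open import Data.Fin.Subset using (Subset; _∈_; _∉_; _∩_; ∁; _─_; ⁅_⁆; ∣_∣)
open import Data.Product using (Σ; ∃; ∃-syntax; _×_)
open import Data.Sum using (_⊎_)
open import Relation.Nullary using (¬_)
open import Relation.Binary.PropositionalEquality using (_≡_; _≢_)
open import Relation.Binary.Construct.Closure.ReflexiveTransitive using (Star)
open import Function.Bundles using (_⇔_)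

-- A finite simple graph on vertex set Fin n, given by neighbourhoods,
-- together with a split partition V^A (= A, a clique) ∪ U^B (= ∁ A,
-- an independent set), where every vertex of U^B has a neighbour in V^A.
record SplitGraph (n : ℕ) : Set where
  field
    nbr        : Fin n → Subset n
    irrefl     : ∀ x → x ∉ nbr x
    sym        : ∀ x y → y ∈ nbr x → x ∈ nbr y
    A          : Subset n
    A-clique   : ∀ x y → x ∈ A → y ∈ A → x ≢ y → y ∈ nbr x
    U-indep    : ∀ x y → x ∉ A → y ∉ A → y ∉ nbr x
    U-covered  : ∀ u → u ∉ A → ∃[ a ] (a ∈ A × a ∈ nbr u)

module _ {n : ℕ} (G : SplitGraph n) where
  open SplitGraph G

  Adj : Fin n → Fin n → Set
  Adj x y = y ∈ nbr x

  Dist≤2 : Fin n → Fin n → Set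
  Dist≤2 u v = u ≡ v ⊎ Adj u v ⊎ ∃[ w ] (Adj u w × Adj w v)

  Independent : Subset n → Set
  Independent I = ∀ x y → x ∈ I → y ∈ I → ¬ Adj x y

  Step₂ : Subset n → Subset n → Set
  Step₂ I J = Independent I × Independent J ×
              ∃[ u ] ∃[ v ] ((I ─ J) ≡ ⁅ u ⁆ × (J ─ I) ≡ ⁅ v ⁆ × Dist≤2 u v)

  Reach₂ : Subset n → Subset n → Set
  Reach₂ = Star Step₂

  InVB : Fin n → Set
  InVB x = x ∈ A × ∃[ u ] (u ∉ A × Adj x u)

  InGB : Fin n → Set
  InGB x = InVB x ⊎ x ∉ A

  EdgeB : Fin n → Fin n → Set
  EdgeB x y = Adj x y × ((x ∈ A × y ∉ A) ⊎ (x ∉ A × y ∈ A))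

  IsComponentB : Subset n → Set
  IsComponentB C = ∃[ x ] (InGB x × (∀ y → (y ∈ C ⇔ Star EdgeB x y)))

  -- C is a cluster: a component of G^B, or V' = V^A \ V^B when nonempty.
  -- The cluster (U_C, V_C, E_C) has U_C = C ∩ U^B and V_C = C ∩ V^A.
  IsCluster : Subset n → Set
  IsCluster C = IsComponentB C
              ⊎ ((∀ y → (y ∈ C ⇔ (y ∈ A × ¬ InVB y))) × ∃[ y ] (y ∈ C))

  U-of : Subset n → Subset n
  U-of C = C ∩ ∁ A

  -- N_C(v) : neighbours of v inside the cluster C (edges of C go to U_C)
  N-in : Subset n → Fin n → Subset n
  N-in C v = nbr v ∩ U-of C

  deg-in : Subset n → Fin n → ℕ
  deg-in C v = ∣ N-in C v ∣

  IsMinDeg : Subset n → Fin n → Set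
  IsMinDeg C v = (v ∈ C × v ∈ A) × (∀ w → w ∈ C → w ∈ A → deg-in C v ≤ deg-in C w)

  Typical : Subset n → Set
  Typical I = Independent I × (∀ x → x ∈ I → x ∉ A)

  SameDist : Subset n → Subset n → Set
  SameDist I J = ∀ C → IsCluster C → ∣ I ∩ U-of C ∣ ≡ ∣ J ∩ U-of C ∣

  -- φ_C(I) = k  (for the fixed minimum-degree vertex v of C):
  -- k is the minimum of |N_C(v) ∩ J| over typical J with the same distribution as I
  IsPhi : Subset n → Fin n → Subset n → ℕ → Set
  IsPhi C v I k =
    (∃[ J ] (Typical J × SameDist I J × ∣ N-in C v ∩ J ∣ ≡ k)) ×
    (∀ J → Typical J → SameDist I J → k ≤ ∣ N-in C v ∩ J ∣)

  Free : Subset n → Fin n → Subset n → Set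
  Free C v I = IsPhi C v I 0

{-# OPTIONS --safe #-}
-- Typical sets live in the independent side U^B, where a token may always jump to a free
-- vertex at distance two; along the common-neighbour paths of a cluster, a token can
-- therefore be carried to any free vertex of the same cluster.  Freeness of C says that
-- U_C ∖ N(v) has room for all tokens of I_s in U_C, so I_s can be rearranged to avoid
-- N(v), and likewise I_t.  Once neither set meets N(v), the clique vertex v is a hub:
-- any token jumps x → v → y, so the two rearranged sets, having the same size, are
-- joined one token at a time.
module Submission where

open import Defs
open import Data.Nat using (ℕ; suc; _≤_; _<_; z≤n)
open import Data.Nat.Properties using (≤-reflexive; <⇒≱; module ≤-Reasoning)
open import Data.Nat.Induction using (<-wellFounded)
open import Induction.WellFounded using (Acc; acc)
open import Data.Fin using (Fin)
open import Data.Fin.Properties using (any?) renaming (_≟_ to _≟ᶠ_)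
open import Data.Fin.Subset
  using (Subset; ∣_∣; _∈_; _∉_; _⊆_; _⊂_; _∩_; _∪_; ∁; _─_; _-_; ⁅_⁆; inside; outside)
open import Data.Fin.Subset.Properties
  using (_∈?_; nonempty?; ⊆-antisym; p⊆q⇒∣p∣≤∣q∣; p⊂q⇒∣p∣<∣q∣; x∈p⇒∣p-x∣<∣p∣; p─⊥≡p; p─q⊆p;
         x∈p∩q⁺; x∈p∩q⁻; x∈p∪q⁺; x∈p∪q⁻; x∈p∧x∉q⇒x∈p─q; x∈p∧x≢y⇒x∈p-y;
         x∈⁅x⁆; x∈⁅y⁆⇒x≡y; x∉⁅y⁆⇒x≢y; x∈p⇒x∉∁p; x∉p⇒x∈∁p; x∈∁p⇒x∉p)
open import Data.Vec using (_∷_; here; there)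
open import Data.Product using (∃-syntax; _×_; _,_; proj₁; proj₂)
open import Data.Sum using (_⊎_; inj₁; inj₂; [_,_])
open import Data.Empty using (⊥-elim)
open import Function using (_∘_)
open import Function.Bundles using (Equivalence)
open import Relation.Nullary using (¬_; yes; no)
open import Relation.Nullary.Decidable using (_×-dec_; ¬?; decidable-stable)
open import Relation.Binary.PropositionalEquality
  using (_≡_; _≢_; refl; sym; trans; cong; subst; module ≡-Reasoning)
open import Relation.Binary.Construct.Closure.ReflexiveTransitive using (Star; ε; _◅_; _◅◅_; reverse)

module _ {X : Set} {_⟶_ : X → X → Set} (μ : X → ℕ) (Inv Done : X → Set) where

  star-descent : (∀ x → Inv x → Done x ⊎ ∃[ y ] (Star _⟶_ x y × Inv y × μ y < μ x)) →
                 ∀ x → Inv x → ∃[ y ] (Star _⟶_ x y × Inv y × Done y)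
  star-descent step x inv = go x inv (<-wellFounded (μ x))
    where
    go : ∀ x → Inv x → Acc _<_ (μ x) → ∃[ y ] (Star _⟶_ x y × Inv y × Done y)
    go x inv (acc rec) with step x inv
    ... | inj₁ done = x , ε , inv , done
    ... | inj₂ (y , x⟶y , inv′ , μy<μx) =
      let z , y⟶z , rest = go y inv′ (rec μy<μx) in z , x⟶y ◅◅ y⟶z , rest

private variable
  n : ℕ
  p q : Subset n
  x y z : Fin n

x∈p─q⇒x∉q : x ∈ p ─ q → x ∉ q
x∈p─q⇒x∉q {p = _ ∷ _} {q = inside ∷ _} () here
x∈p─q⇒x∉q {p = _ ∷ _} {q = _ ∷ _} (there x∈p─q) (there x∈q) = x∈p─q⇒x∉q x∈p─q x∈q

x∈p-y⁻ : x ∈ p - y → x ∈ p × x ≢ y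
x∈p-y⁻ {p = p} {y = y} x∈p-y = p─q⊆p p ⁅ y ⁆ x∈p-y , x∉⁅y⁆⇒x≢y (x∈p─q⇒x∉q x∈p-y)

x∈p⇒∣p∣≡1+∣p-x∣ : x ∈ p → ∣ p ∣ ≡ suc ∣ p - x ∣
x∈p⇒∣p∣≡1+∣p-x∣ {p = inside ∷ p} here = cong suc (sym (cong ∣_∣ (p─⊥≡p p)))
x∈p⇒∣p∣≡1+∣p-x∣ {p = inside ∷ _} (there x∈p) = cong suc (x∈p⇒∣p∣≡1+∣p-x∣ x∈p)
x∈p⇒∣p∣≡1+∣p-x∣ {p = outside ∷ _} (there x∈p) = x∈p⇒∣p∣≡1+∣p-x∣ x∈p

∣p∣≡0⇒x∉p : ∣ p ∣ ≡ 0 → x ∉ p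
∣p∣≡0⇒x∉p {p = p} {x = x} ∣p∣≡0 x∈p =
  <⇒≱ (x∈p⇒∣p-x∣<∣p∣ x∈p) (subst (_≤ ∣ p - x ∣) (sym ∣p∣≡0) z≤n)

⊆-or-witness : p ⊆ q ⊎ ∃[ x ] (x ∈ p × x ∉ q)
⊆-or-witness {p = p} {q = q} with any? (λ x → x ∈? p ×-dec ¬? (x ∈? q))
... | yes witness = inj₂ witness
... | no none = inj₁ λ {x} x∈p → decidable-stable (x ∈? q) λ x∉q → none (x , x∈p , x∉q)

∣p∣≤∣q∣∧x∈p∖q⇒∃y∈q∖p : ∣ p ∣ ≤ ∣ q ∣ → x ∈ p → x ∉ q → ∃[ y ] (y ∈ q × y ∉ p)
∣p∣≤∣q∣∧x∈p∖q⇒∃y∈q∖p {p = p} {q = q} {x = x} ∣p∣≤∣q∣ x∈p x∉q with ⊆-or-witness {p = q} {q = p}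
... | inj₂ witness = witness
... | inj₁ q⊆p = ⊥-elim (<⇒≱ (p⊂q⇒∣p∣<∣q∣ (q⊆p , x , x∈p , x∉q)) ∣p∣≤∣q∣)

p⊆q∧∣q∣≤∣p∣⇒p≡q : p ⊆ q → ∣ q ∣ ≤ ∣ p ∣ → p ≡ q
p⊆q∧∣q∣≤∣p∣⇒p≡q {p = p} {q = q} p⊆q ∣q∣≤∣p∣ with ⊆-or-witness {p = q} {q = p}
... | inj₁ q⊆p = ⊆-antisym p⊆q q⊆p
... | inj₂ (y , y∈q , y∉p) =
  let z , z∈p , z∉q = ∣p∣≤∣q∣∧x∈p∖q⇒∃y∈q∖p ∣q∣≤∣p∣ y∈q y∉p in ⊥-elim (z∉q (p⊆q z∈p))

infixl 8 _[_↦_]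

_[_↦_] : Subset n → Fin n → Fin n → Subset n
p [ x ↦ y ] = (p - x) ∪ ⁅ y ⁆

∈-↦-target : y ∈ p [ x ↦ y ]
∈-↦-target {y = y} = x∈p∪q⁺ (inj₂ (x∈⁅x⁆ y))

∈-↦-kept : z ∈ p → z ≢ x → z ∈ p [ x ↦ y ]
∈-↦-kept z∈p z≢x = x∈p∪q⁺ (inj₁ (x∈p∧x≢y⇒x∈p-y z∈p z≢x))

∈-↦⁻ : z ∈ p [ x ↦ y ] → (z ∈ p × z ≢ x) ⊎ z ≡ y
∈-↦⁻ {p = p} {x = x} {y = y} z∈p[x↦y] with x∈p∪q⁻ (p - x) ⁅ y ⁆ z∈p[x↦y]
... | inj₁ z∈p-x = inj₁ (x∈p-y⁻ z∈p-x)
... | inj₂ z∈⁅y⁆ = inj₂ (x∈⁅y⁆⇒x≡y y z∈⁅y⁆)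

x∉p[x↦y] : x ∈ p → y ∉ p → x ∉ p [ x ↦ y ]
x∉p[x↦y] x∈p y∉p x∈p[x↦y] with ∈-↦⁻ x∈p[x↦y]
... | inj₁ (_ , x≢x) = x≢x refl
... | inj₂ refl = y∉p x∈p

z∉p[x↦y] : z ∉ p → z ≢ y → z ∉ p [ x ↦ y ]
z∉p[x↦y] z∉p z≢y z∈p[x↦y] with ∈-↦⁻ z∈p[x↦y]
... | inj₁ (z∈p , _) = z∉p z∈p
... | inj₂ z≡y = z≢y z≡y

p[x↦y]-y≡p-x : y ∉ p → p [ x ↦ y ] - y ≡ p - x
p[x↦y]-y≡p-x {y = y} {p = p} {x = x} y∉p = ⊆-antisym forth back
  where
  forth : p [ x ↦ y ] - y ⊆ p - x
  forth z∈ with x∈p-y⁻ z∈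
  ... | z∈p[x↦y] , z≢y with ∈-↦⁻ z∈p[x↦y]
  ...   | inj₁ (z∈p , z≢x) = x∈p∧x≢y⇒x∈p-y z∈p z≢x
  ...   | inj₂ z≡y = ⊥-elim (z≢y z≡y)
  back : p - x ⊆ p [ x ↦ y ] - y
  back z∈p-x with x∈p-y⁻ z∈p-x
  ... | z∈p , z≢x = x∈p∧x≢y⇒x∈p-y (∈-↦-kept z∈p z≢x) λ { refl → y∉p z∈p }

∣p[x↦y]∣≡∣p∣ : x ∈ p → y ∉ p → ∣ p [ x ↦ y ] ∣ ≡ ∣ p ∣
∣p[x↦y]∣≡∣p∣ {x = x} {p = p} {y = y} x∈p y∉p = begin
  ∣ p [ x ↦ y ] ∣         ≡⟨ x∈p⇒∣p∣≡1+∣p-x∣ {p = p [ x ↦ y ]} ∈-↦-target ⟩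
  suc ∣ p [ x ↦ y ] - y ∣ ≡⟨ cong (suc ∘ ∣_∣) (p[x↦y]-y≡p-x y∉p) ⟩
  suc ∣ p - x ∣           ≡⟨ sym (x∈p⇒∣p∣≡1+∣p-x∣ x∈p) ⟩
  ∣ p ∣                   ∎
  where open ≡-Reasoning

p─p[x↦y]≡⁅x⁆ : x ∈ p → y ∉ p → p ─ p [ x ↦ y ] ≡ ⁅ x ⁆
p─p[x↦y]≡⁅x⁆ {x = x} {p = p} {y = y} x∈p y∉p = ⊆-antisym forth back
  where
  forth : p ─ p [ x ↦ y ] ⊆ ⁅ x ⁆
  forth {z} z∈ with z ≟ᶠ x
  ... | yes refl = x∈⁅x⁆ x
  ... | no z≢x = ⊥-elim (x∈p─q⇒x∉q z∈ (∈-↦-kept (p─q⊆p p _ z∈) z≢x))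
  back : ⁅ x ⁆ ⊆ p ─ p [ x ↦ y ]
  back z∈⁅x⁆ with x∈⁅y⁆⇒x≡y x z∈⁅x⁆
  ... | refl = x∈p∧x∉q⇒x∈p─q x∈p (x∉p[x↦y] x∈p y∉p)

p[x↦y]─p≡⁅y⁆ : y ∉ p → p [ x ↦ y ] ─ p ≡ ⁅ y ⁆
p[x↦y]─p≡⁅y⁆ {y = y} {p = p} {x = x} y∉p = ⊆-antisym forth back
  where
  forth : p [ x ↦ y ] ─ p ⊆ ⁅ y ⁆
  forth z∈ with ∈-↦⁻ (p─q⊆p _ p z∈)
  ... | inj₁ (z∈p , _) = ⊥-elim (x∈p─q⇒x∉q z∈ z∈p)
  ... | inj₂ refl = x∈⁅x⁆ y
  back : ⁅ y ⁆ ⊆ p [ x ↦ y ] ─ p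
  back z∈⁅y⁆ with x∈⁅y⁆⇒x≡y y z∈⁅y⁆
  ... | refl = x∈p∧x∉q⇒x∈p─q ∈-↦-target y∉p

p[x↦z][z↦y]≡p[x↦y] : z ∉ p → p [ x ↦ z ] [ z ↦ y ] ≡ p [ x ↦ y ]
p[x↦z][z↦y]≡p[x↦y] {z = z} {p = p} {x = x} {y = y} z∉p = ⊆-antisym forth back
  where
  forth : p [ x ↦ z ] [ z ↦ y ] ⊆ p [ x ↦ y ]
  forth w∈ with ∈-↦⁻ w∈
  ... | inj₂ refl = ∈-↦-target
  ... | inj₁ (w∈p[x↦z] , w≢z) with ∈-↦⁻ w∈p[x↦z]
  ...   | inj₁ (w∈p , w≢x) = ∈-↦-kept w∈p w≢x
  ...   | inj₂ w≡z = ⊥-elim (w≢z w≡z)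
  back : p [ x ↦ y ] ⊆ p [ x ↦ z ] [ z ↦ y ]
  back w∈ with ∈-↦⁻ w∈
  ... | inj₂ refl = ∈-↦-target
  ... | inj₁ (w∈p , w≢x) = ∈-↦-kept (∈-↦-kept w∈p w≢x) λ { refl → z∉p w∈p }

p[z↦y][x↦z]≡p[x↦y] : x ∈ p → z ∈ p → x ≢ z → y ∉ p → p [ z ↦ y ] [ x ↦ z ] ≡ p [ x ↦ y ]
p[z↦y][x↦z]≡p[x↦y] {x = x} {p = p} {z = z} {y = y} x∈p z∈p x≢z y∉p = ⊆-antisym forth back
  where
  forth : p [ z ↦ y ] [ x ↦ z ] ⊆ p [ x ↦ y ]
  forth w∈ with ∈-↦⁻ w∈
  ... | inj₂ refl = ∈-↦-kept z∈p (x≢z ∘ sym)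
  ... | inj₁ (w∈p[z↦y] , w≢x) with ∈-↦⁻ w∈p[z↦y]
  ...   | inj₁ (w∈p , _) = ∈-↦-kept w∈p w≢x
  ...   | inj₂ refl = ∈-↦-target
  back : p [ x ↦ y ] ⊆ p [ z ↦ y ] [ x ↦ z ]
  back {w} w∈ with ∈-↦⁻ w∈ | w ≟ᶠ z
  ... | _ | yes refl = ∈-↦-target
  ... | inj₂ refl | no _ = ∈-↦-kept ∈-↦-target λ { refl → y∉p x∈p }
  ... | inj₁ (w∈p , w≢x) | no w≢z = ∈-↦-kept (∈-↦-kept w∈p w≢z) w≢x

p[x↦y]∩q≡[p∩q][x↦y] : x ∈ q → y ∈ q → p [ x ↦ y ] ∩ q ≡ (p ∩ q) [ x ↦ y ]
p[x↦y]∩q≡[p∩q][x↦y] {x = x} {q = q} {y = y} {p = p} x∈q y∈q = ⊆-antisym forth back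
  where
  forth : p [ x ↦ y ] ∩ q ⊆ (p ∩ q) [ x ↦ y ]
  forth w∈ with x∈p∩q⁻ (p [ x ↦ y ]) q w∈
  ... | w∈p[x↦y] , w∈q with ∈-↦⁻ w∈p[x↦y]
  ...   | inj₁ (w∈p , w≢x) = ∈-↦-kept (x∈p∩q⁺ (w∈p , w∈q)) w≢x
  ...   | inj₂ refl = ∈-↦-target
  back : (p ∩ q) [ x ↦ y ] ⊆ p [ x ↦ y ] ∩ q
  back w∈ with ∈-↦⁻ w∈
  ... | inj₂ refl = x∈p∩q⁺ (∈-↦-target , y∈q)
  ... | inj₁ (w∈p∩q , w≢x) with x∈p∩q⁻ p q w∈p∩q
  ...   | w∈p , w∈q = x∈p∩q⁺ (∈-↦-kept w∈p w≢x , w∈q)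

p[x↦y]∩q⊂p∩q : x ∈ p → x ∈ q → y ∉ q → p [ x ↦ y ] ∩ q ⊂ p ∩ q
p[x↦y]∩q⊂p∩q {x = x} {p = p} {q = q} {y = y} x∈p x∈q y∉q = kept , x , x∈p∩q⁺ (x∈p , x∈q) , removed
  where
  kept : p [ x ↦ y ] ∩ q ⊆ p ∩ q
  kept w∈ with x∈p∩q⁻ (p [ x ↦ y ]) q w∈
  ... | w∈p[x↦y] , w∈q with ∈-↦⁻ w∈p[x↦y]
  ...   | inj₁ (w∈p , _) = x∈p∩q⁺ (w∈p , w∈q)
  ...   | inj₂ refl = ⊥-elim (y∉q w∈q)
  removed : x ∉ p [ x ↦ y ] ∩ q
  removed x∈ with ∈-↦⁻ (proj₁ (x∈p∩q⁻ (p [ x ↦ y ]) q x∈))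
  ... | inj₁ (_ , x≢x) = x≢x refl
  ... | inj₂ refl = y∉q x∈q

module _ (G : SplitGraph n) where
  open SplitGraph G renaming (sym to adj-sym)

  private variable
    I J T C : Subset n
    a u v : Fin n

  typical : (∀ x → x ∈ I → x ∉ A) → Typical G I
  typical I⊆U = (λ x y x∈I y∈I → U-indep x y (I⊆U x x∈I) (I⊆U y y∈I)) , I⊆U

  typical-↦ : Typical G I → y ∉ A → Typical G (I [ x ↦ y ])
  typical-↦ (_ , I⊆U) y∉A =
    typical λ z z∈ → [ (λ (z∈I , _) → I⊆U z z∈I) , (λ { refl → y∉A }) ] (∈-↦⁻ z∈)

  Dist≤2-sym : Dist≤2 G x y → Dist≤2 G y x
  Dist≤2-sym (inj₁ refl) = inj₁ refl
  Dist≤2-sym (inj₂ (inj₁ x~y)) = inj₂ (inj₁ (adj-sym _ _ x~y))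
  Dist≤2-sym (inj₂ (inj₂ (w , x~w , w~y))) = inj₂ (inj₂ (w , adj-sym _ _ w~y , adj-sym _ _ x~w))

  Dist≤2-U-A : u ∉ A → a ∈ A → Dist≤2 G u a
  Dist≤2-U-A {u} {a} u∉A a∈A with U-covered u u∉A
  ... | w , w∈A , u~w with w ≟ᶠ a
  ...   | yes refl = inj₂ (inj₁ u~w)
  ...   | no w≢a = inj₂ (inj₂ (w , u~w , A-clique w a w∈A a∈A w≢a))

  Reach₂-sym : Reach₂ G I J → Reach₂ G J I
  Reach₂-sym = reverse λ (I-ind , J-ind , u , v , I─J , J─I , d) →
    J-ind , I-ind , v , u , J─I , I─J , Dist≤2-sym d

  Step₂-↦ : Independent G I → Independent G (I [ x ↦ y ]) → x ∈ I → y ∉ I → Dist≤2 G x y →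
            Step₂ G I (I [ x ↦ y ])
  Step₂-↦ I-ind J-ind x∈I y∉I d = I-ind , J-ind , _ , _ , p─p[x↦y]≡⁅x⁆ x∈I y∉I , p[x↦y]─p≡⁅y⁆ y∉I , d

  Movable : Fin n → Fin n → Set
  Movable x y = ∀ I → Typical G I → x ∈ I → y ∉ I → Reach₂ G I (I [ x ↦ y ])

  movable-Dist≤2 : y ∉ A → Dist≤2 G x y → Movable x y
  movable-Dist≤2 y∉A d I I-typ x∈I y∉I =
    Step₂-↦ (proj₁ I-typ) (proj₁ (typical-↦ I-typ y∉A)) x∈I y∉I d ◅ ε

  -- If z is occupied, first move its token on to y and then move x into the vacated z.
  movable-trans : z ∉ A → y ∉ A → Movable x z → Movable z y → Movable x y
  movable-trans {z} {y} {x} z∉A y∉A x⇝z z⇝y I I-typ x∈I y∉I with z ∈? I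
  ... | no z∉I with z ≟ᶠ y
  ...   | yes refl = x⇝z I I-typ x∈I z∉I
  ...   | no z≢y = x⇝z I I-typ x∈I z∉I
                   ◅◅ subst (Reach₂ G (I [ x ↦ z ])) (p[x↦z][z↦y]≡p[x↦y] z∉I)
                        (z⇝y _ (typical-↦ I-typ z∉A) ∈-↦-target (z∉p[x↦y] y∉I (z≢y ∘ sym)))
  movable-trans {z} {y} {x} z∉A y∉A x⇝z z⇝y I I-typ x∈I y∉I | yes z∈I with x ≟ᶠ z
  ...   | yes refl = z⇝y I I-typ z∈I y∉I
  ...   | no x≢z = z⇝y I I-typ z∈I y∉I
                   ◅◅ subst (Reach₂ G (I [ z ↦ y ])) (p[z↦y][x↦z]≡p[x↦y] x∈I z∈I x≢z y∉I)
                        (x⇝z _ (typical-↦ I-typ y∉A) (∈-↦-kept x∈I x≢z) (x∉p[x↦y] z∈I y∉I))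

  NearU : Fin n → Fin n → Set
  NearU x y = y ∉ A × Dist≤2 G x y

  movable-path : y ∉ A → Star NearU x y → Movable x y
  movable-path y∉A ε I _ x∈I x∉I = ⊥-elim (x∉I x∈I)
  movable-path y∉A ((z∉A , d) ◅ z⇝y) =
    movable-trans z∉A y∉A (movable-Dist≤2 z∉A d) (movable-path y∉A z⇝y)

  EdgeB-sym : EdgeB G x y → EdgeB G y x
  EdgeB-sym (x~y , inj₁ (x∈A , y∉A)) = adj-sym _ _ x~y , inj₂ (y∉A , x∈A)
  EdgeB-sym (x~y , inj₂ (x∉A , y∈A)) = adj-sym _ _ x~y , inj₁ (y∈A , x∉A)

  EdgeB-path⇒NearU-path : Star (EdgeB G) x y → x ∉ A → y ∉ A → Star NearU x y
  EdgeB-path⇒NearU-path ε _ _ = ε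
  EdgeB-path⇒NearU-path ((_ , inj₁ (x∈A , _)) ◅ _) x∉A _ = ⊥-elim (x∉A x∈A)
  EdgeB-path⇒NearU-path ((_ , inj₂ (_ , y∈A)) ◅ ε) _ y∉A = ⊥-elim (y∉A y∈A)
  EdgeB-path⇒NearU-path ((_ , inj₂ (_ , w∈A)) ◅ (_ , inj₂ (w∉A , _)) ◅ _) _ _ = ⊥-elim (w∉A w∈A)
  EdgeB-path⇒NearU-path ((x~w , inj₂ _) ◅ (w~z , inj₁ (_ , z∉A)) ◅ z⇝y) _ y∉A =
    (z∉A , inj₂ (inj₂ (_ , x~w , w~z))) ◅ EdgeB-path⇒NearU-path z⇝y z∉A y∉A

  ∈U-of⁻ : x ∈ U-of G C → x ∈ C × x ∉ A
  ∈U-of⁻ {C = C} x∈ = let x∈C , x∈∁A = x∈p∩q⁻ C (∁ A) x∈ in x∈C , x∈∁p⇒x∉p x∈∁A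

  cluster-U-path : IsCluster G C → x ∈ U-of G C → y ∈ U-of G C → Star NearU x y
  cluster-U-path {x = x} {y = y} (inj₁ (_ , _ , C≡reach)) x∈ y∈ =
    let x∈C , x∉A = ∈U-of⁻ x∈ ; y∈C , y∉A = ∈U-of⁻ y∈
        r⇝x = Equivalence.to (C≡reach x) x∈C ; r⇝y = Equivalence.to (C≡reach y) y∈C
    in EdgeB-path⇒NearU-path (reverse EdgeB-sym r⇝x ◅◅ r⇝y) x∉A y∉A
  cluster-U-path {x = x} (inj₂ (C≡V′ , _)) x∈ _ =
    let x∈C , x∉A = ∈U-of⁻ x∈ in ⊥-elim (x∉A (proj₁ (Equivalence.to (C≡V′ x) x∈C)))

  cluster-closed : IsCluster G C → v ∈ C → v ∈ A → z ∉ A → Adj G v z → z ∈ C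
  cluster-closed {v = v} {z = z} (inj₁ (_ , _ , C≡reach)) v∈C v∈A z∉A v~z =
    Equivalence.from (C≡reach z) (Equivalence.to (C≡reach v) v∈C ◅◅ (v~z , inj₁ (v∈A , z∉A)) ◅ ε)
  cluster-closed {v = v} {z = z} (inj₂ (C≡V′ , _)) v∈C v∈A z∉A v~z =
    ⊥-elim (proj₂ (Equivalence.to (C≡V′ v) v∈C) (v∈A , z , z∉A , v~z))

  NoNbrIn : Fin n → Subset n → Set
  NoNbrIn v I = ∀ z → z ∈ I → ¬ Adj G v z

  NoNbrIn-↦ : NoNbrIn v I → ¬ Adj G v y → NoNbrIn v (I [ x ↦ y ])
  NoNbrIn-↦ v-free v≁y z z∈ with ∈-↦⁻ z∈
  ... | inj₁ (z∈I , _) = v-free z z∈I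
  ... | inj₂ refl = v≁y

  via-hub : v ∈ A → Typical G I → NoNbrIn v I → x ∈ I → y ∉ I → y ∉ A → Reach₂ G I (I [ x ↦ y ])
  via-hub {v} {I} {x} {y} v∈A I-typ@(I-ind , I⊆U) v-free x∈I y∉I y∉A =
    Step₂-↦ I-ind Iᵥ-ind x∈I v∉I (Dist≤2-U-A (I⊆U x x∈I) v∈A)
    ◅ subst (Step₂ G Iᵥ) (p[x↦z][z↦y]≡p[x↦y] v∉I)
        (Step₂-↦ Iᵥ-ind Iᵥ′-ind ∈-↦-target y∉Iᵥ (Dist≤2-sym (Dist≤2-U-A y∉A v∈A)))
    ◅ ε
    where
    Iᵥ = I [ x ↦ v ]
    v∉I : v ∉ I
    v∉I v∈I = I⊆U v v∈I v∈A
    y∉Iᵥ : y ∉ Iᵥ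
    y∉Iᵥ = z∉p[x↦y] y∉I λ { refl → y∉A v∈A }
    Iᵥ-ind : Independent G Iᵥ
    Iᵥ-ind a b a∈Iᵥ b∈Iᵥ with ∈-↦⁻ a∈Iᵥ | ∈-↦⁻ b∈Iᵥ
    ... | inj₁ (a∈I , _) | inj₁ (b∈I , _) = I-ind a b a∈I b∈I
    ... | inj₁ (a∈I , _) | inj₂ refl = v-free a a∈I ∘ adj-sym a v
    ... | inj₂ refl | inj₁ (b∈I , _) = v-free b b∈I
    ... | inj₂ refl | inj₂ refl = irrefl v
    Iᵥ′-ind : Independent G (Iᵥ [ v ↦ y ])
    Iᵥ′-ind = subst (Independent G) (sym (p[x↦z][z↦y]≡p[x↦y] v∉I)) (proj₁ (typical-↦ I-typ y∉A))

  hub-connected : v ∈ A → Typical G I → Typical G T → NoNbrIn v I → NoNbrIn v T →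
                  ∣ I ∣ ≡ ∣ T ∣ → Reach₂ G I T
  hub-connected {v} {I} {T} v∈A I-typ T-typ@(_ , T⊆U) I-free T-free ∣I∣≡∣T∣ =
    let J , I⇝J , _ , J≡T =
          star-descent (λ J → ∣ J ∩ ∁ T ∣) Inv (_≡ T) step I (I-typ , I-free , ∣I∣≡∣T∣)
    in subst (Reach₂ G I) J≡T I⇝J
    where
    Inv : Subset n → Set
    Inv J = Typical G J × NoNbrIn v J × ∣ J ∣ ≡ ∣ T ∣
    step : ∀ J → Inv J → J ≡ T ⊎ ∃[ J′ ] (Reach₂ G J J′ × Inv J′ × ∣ J′ ∩ ∁ T ∣ < ∣ J ∩ ∁ T ∣)
    step J (J-typ , J-free , ∣J∣≡∣T∣) with ⊆-or-witness {p = J} {q = T}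
    ... | inj₁ J⊆T = inj₁ (p⊆q∧∣q∣≤∣p∣⇒p≡q J⊆T (≤-reflexive (sym ∣J∣≡∣T∣)))
    ... | inj₂ (x , x∈J , x∉T) =
      let y , y∈T , y∉J = ∣p∣≤∣q∣∧x∈p∖q⇒∃y∈q∖p (≤-reflexive ∣J∣≡∣T∣) x∈J x∉T
          y∉A = T⊆U y y∈T
      in inj₂ (J [ x ↦ y ]
              , via-hub v∈A J-typ J-free x∈J y∉J y∉A
              , ( typical-↦ J-typ y∉A , NoNbrIn-↦ J-free (T-free y y∈T)
                , trans (∣p[x↦y]∣≡∣p∣ x∈J y∉J) ∣J∣≡∣T∣)
              , p⊂q⇒∣p∣<∣q∣ (p[x↦y]∩q⊂p∩q x∈J (x∉p⇒x∈∁p x∉T) (x∈p⇒x∉∁p y∈T)))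

  module _ (C-cl : IsCluster G C) (v∈C : v ∈ C) (v∈A : v ∈ A) where
    private
      N = N-in G C v
      UC = U-of G C

    free⇒room : Free G C v I → ∣ I ∩ UC ∣ ≤ ∣ UC ∩ ∁ N ∣
    free⇒room {I} ((J , _ , I≈J , ∣N∩J∣≡0) , _) = begin
      ∣ I ∩ UC ∣     ≡⟨ I≈J C C-cl ⟩
      ∣ J ∩ UC ∣     ≤⟨ p⊆q⇒∣p∣≤∣q∣ J∩UC⊆UC∖N ⟩
      ∣ UC ∩ ∁ N ∣   ∎
      where
      open ≤-Reasoning
      J∩UC⊆UC∖N : J ∩ UC ⊆ UC ∩ ∁ N
      J∩UC⊆UC∖N z∈ =
        let z∈J , z∈UC = x∈p∩q⁻ J UC z∈
        in x∈p∩q⁺ (z∈UC , x∉p⇒x∈∁p λ z∈N → ∣p∣≡0⇒x∉p ∣N∩J∣≡0 (x∈p∩q⁺ (z∈N , z∈J)))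

    evacuate : Typical G I → ∣ I ∩ UC ∣ ≤ ∣ UC ∩ ∁ N ∣ →
               ∃[ I′ ] (Reach₂ G I I′ × Typical G I′ × ∣ I′ ∣ ≡ ∣ I ∣ × NoNbrIn v I′)
    evacuate {I} I-typ I-room =
      let I′ , I⇝I′ , (I′-typ , ∣I′∣≡∣I∣ , _) , I′-free =
            star-descent (λ J → ∣ J ∩ N ∣) Inv (NoNbrIn v) step I (I-typ , refl , I-room)
      in I′ , I⇝I′ , I′-typ , ∣I′∣≡∣I∣ , I′-free
      where
      Inv : Subset n → Set
      Inv J = Typical G J × ∣ J ∣ ≡ ∣ I ∣ × ∣ J ∩ UC ∣ ≤ ∣ UC ∩ ∁ N ∣
      step : ∀ J → Inv J → NoNbrIn v J ⊎ ∃[ J′ ] (Reach₂ G J J′ × Inv J′ × ∣ J′ ∩ N ∣ < ∣ J ∩ N ∣)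
      step J (J-typ@(_ , J⊆U) , ∣J∣≡∣I∣ , J-room) with nonempty? (J ∩ N)
      ... | no J∩N≡∅ = inj₁ λ z z∈J v~z →
        let z∉A = J⊆U z z∈J
            z∈UC = x∈p∩q⁺ (cluster-closed C-cl v∈C v∈A z∉A v~z , x∉p⇒x∈∁p z∉A)
        in J∩N≡∅ (z , x∈p∩q⁺ (z∈J , x∈p∩q⁺ (v~z , z∈UC)))
      ... | yes (x , x∈J∩N) =
        let x∈J , x∈N = x∈p∩q⁻ J N x∈J∩N
            x∈UC = proj₂ (x∈p∩q⁻ (nbr v) UC x∈N)
            y , y∈UC∖N , y∉J∩UC = ∣p∣≤∣q∣∧x∈p∖q⇒∃y∈q∖p J-room (x∈p∩q⁺ (x∈J , x∈UC))
                                    (λ x∈UC∖N → x∈∁p⇒x∉p (proj₂ (x∈p∩q⁻ UC (∁ N) x∈UC∖N)) x∈N)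
            y∈UC , y∈∁N = x∈p∩q⁻ UC (∁ N) y∈UC∖N
            y∉J = λ y∈J → y∉J∩UC (x∈p∩q⁺ (y∈J , y∈UC))
            y∉A = proj₂ (∈U-of⁻ y∈UC)
            ∣J′∩UC∣≡∣J∩UC∣ = trans (cong ∣_∣ (p[x↦y]∩q≡[p∩q][x↦y] {p = J} x∈UC y∈UC))
                                   (∣p[x↦y]∣≡∣p∣ (x∈p∩q⁺ (x∈J , x∈UC)) y∉J∩UC)
        in inj₂ (J [ x ↦ y ]
                , movable-path y∉A (cluster-U-path C-cl x∈UC y∈UC) J J-typ x∈J y∉J
                , ( typical-↦ J-typ y∉A , trans (∣p[x↦y]∣≡∣p∣ x∈J y∉J) ∣J∣≡∣I∣
                  , subst (_≤ ∣ UC ∩ ∁ N ∣) (sym ∣J′∩UC∣≡∣J∩UC∣) J-room)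
                , p⊂q⇒∣p∣<∣q∣ (p[x↦y]∩q⊂p∩q x∈J x∈N (x∈∁p⇒x∉p y∈∁N)))

lemma5 : ∀ {n : ℕ} (G : SplitGraph n) (Is It : Subset n) →
    Typical G Is → Typical G It → ∣ Is ∣ ≡ ∣ It ∣ →
    (C : Subset n) → IsCluster G C →
    (v : Fin n) → IsMinDeg G C v →
    Free G C v Is → Free G C v It →
    Reach₂ G Is It
lemma5 G Is It Is-typ It-typ ∣Is∣≡∣It∣ C C-cl v ((v∈C , v∈A) , _) Is-free It-free
  with evacuate G C-cl v∈C v∈A Is-typ (free⇒room G C-cl v∈C v∈A {I = Is} Is-free)
     | evacuate G C-cl v∈C v∈A It-typ (free⇒room G C-cl v∈C v∈A {I = It} It-free)
... | Is′ , Is⇝Is′ , Is′-typ , ∣Is′∣≡∣Is∣ , Is′-clear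
    | It′ , It⇝It′ , It′-typ , ∣It′∣≡∣It∣ , It′-clear =
  Is⇝Is′
  ◅◅ hub-connected G v∈A Is′-typ It′-typ Is′-clear It′-clear ∣Is′∣≡∣It′∣
  ◅◅ Reach₂-sym G It⇝It′
  where
  ∣Is′∣≡∣It′∣ : ∣ Is′ ∣ ≡ ∣ It′ ∣
  ∣Is′∣≡∣It′∣ = trans ∣Is′∣≡∣Is∣ (trans ∣Is∣≡∣It∣ (sym ∣It′∣≡∣It∣))
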